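{- It is not the case that $A^c\Vdash^L_S\neg\neg A^i$ holds for every ecumenical formula $A^c$ and every atomic system $S$.
   Context: Basic setting. Let $\mathsf{At}$ be a countably infinite set of atomic propositions and $\mathsf{At}_\bot=\mathsf{At}\cup\{\bot\}$. An atomic rule has the form "from premises $p_1,\dots,p_n$ ($n\ge 0$) infer $p$", with $p_j,p\in\mathsf{At}_\bot$, where the derivation of each premise may discharge a set of basic sentences. An atomic system $S$ is a set of atomic rules; $S\subseteq S'$ ($S'$ extends $S$) if $S'$ contains all rules of $S$. $\Delta\vdash_S p$ means there is a natural-deduction derivation using only rules of $S$ with conclusion $p$ and undischarged assumptions in $\Delta$ (so $p\vdash_S p$). $S$ is consistent if $\nvdash_S\bot$. Standing convention: all atomic systems (including all extensions quantified over) are required to be consistent. Ecumenical formulas: $p^i,p^c$ for $p\in\mathsf{At}_\bot$; $(A\wedge B)^x,(A\vee B)^x,(A\to B)^x$ for $x\in\{i,c\}$. $A\wedge B$, $A\vee B$, $A\to B$ abbreviate the $i$-versions, $\bot$ denotes $\bot^i$, $\neg A:=(A\to\bot^i)^i$; for $X^c$, $X^i$ is the same construction with outer superscript $i$. Weak validity (by simultaneous recursion): (1) $\Vdash^L_S p^i$ iff $\vdash_S p$ ($p\in\mathsf{At}_\bot$); (2) $\Vdash^L_S p^c$ iff $p\nvdash_S\bot$; (3) for non-atomic $X$, $\Vdash^L_S X^c$ iff $X^i\nVdash^L_S\bot$; (4) $\Vdash^L_S(A\wedge B)^i$ iff $\Vdash^L_S A$ and $\Vdash^L_S B$; (5) $\Vdash^L_S(A\to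 B)^i$ iff $A\Vdash^G_S B$; (6) $\Vdash^L_S(A\vee B)^i$ iff for all $S'\supseteq S$ and all $p\in\mathsf{At}_\bot$, if $A\Vdash^L_{S'}p^i$ and $B\Vdash^L_{S'}p^i$ then $\Vdash^L_{S'}p^i$; (7) for nonempty $\Gamma$, $\Gamma\Vdash^L_S A$ iff for all $S'\supseteq S$, if $\Vdash^L_{S'}B$ for all $B\in\Gamma$ then $\Vdash^L_{S'}A$; (8) $\Gamma\Vdash^G_S A$ iff for all $S'\supseteq S$: if $\Vdash^L_{S''}B$ for all $B\in\Gamma$ and all $S''\supseteq S'$, then $\Vdash^L_{S''}A$ for all $S''\supseteq S'$. -}

module Defs where

open import Level using (Lift; lift) renaming (suc to lsuc; zero to lzero)
open import Data.Nat using (ℕ)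
open import Data.List using (List; []; _∷_; _++_)
open import Data.List.Membership.Propositional using (_∈_)
open import Data.List.Relation.Unary.All using (All)
open import Data.Product using (_×_; proj₁; proj₂)
open import Relation.Nullary using (¬_)

data At⊥ : Set where
  atom : ℕ → At⊥
  bot  : At⊥

-- An atomic rule: list of premises, each with the set (list) of basic
-- sentences its derivation may discharge, and a conclusion.
record Rule : Set where
  constructor mkRule
  field
    prems : List (List At⊥ × At⊥)
    concl : At⊥
open Rule public

System : Set₁
System = Rule → Set

_⊆S_ : System → System → Set
S ⊆S S' = ∀ r → S r → S' r

data _⊢[_]_ (Δ : List At⊥) (S : System) : At⊥ → Set where
  hyp : ∀ {p} → p ∈ Δ → Δ ⊢[ S ] p
  app : (r : Rule) → S r
      → All (λ pr → (proj₁ pr ++ Δ) ⊢[ S ] proj₂ pr) (prems r)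
      → Δ ⊢[ S ] concl r

Consistent : System → Set
Consistent S = ¬ ([] ⊢[ S ] bot)

-- S' is a (consistent) extension of S  (standing convention)
Ext : System → System → Set
Ext S S' = S ⊆S S' × Consistent S'

data Tag : Set where
  i c : Tag

data Form : Set where
  at  : Tag → At⊥ → Form
  and : Tag → Form → Form → Form
  or  : Tag → Form → Form → Form
  imp : Tag → Form → Form → Form

⊥ᵢ : Form
⊥ᵢ = at i bot

neg : Form → Form
neg A = imp i A ⊥ᵢ

withTag : Tag → Form → Form
withTag x (at _ p)    = at x p
withTag x (and _ A B) = and x A B
withTag x (or _ A B)  = or x A B
withTag x (imp _ A B) = imp x A B

VAt : System → At⊥ → Set₁
VAt S p = Lift (lsuc lzero) ([] ⊢[ S ] p)

mutual
  V : System → Form → Set₁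
  V S (at i p)    = VAt S p
  V S (at c p)    = Lift (lsuc lzero) (¬ ((p ∷ []) ⊢[ S ] bot))
  V S (and i A B) = VAnd S A B
  V S (or i A B)  = VOr S A B
  V S (imp i A B) = VImp S A B
  -- clause 3:  X^i ⊮^L_S ⊥  (consequence with one premise, clause 7)
  V S (and c A B) = ¬ (∀ S' → Ext S S' → VAnd S' A B → VAt S' bot)
  V S (or c A B)  = ¬ (∀ S' → Ext S S' → VOr S' A B → VAt S' bot)
  V S (imp c A B) = ¬ (∀ S' → Ext S S' → VImp S' A B → VAt S' bot)

  VAnd : System → Form → Form → Set₁
  VAnd S A B = V S A × V S B

  -- clause 6 (premises A ⊩^L_{S'} p^i via clause 7)
  VOr : System → Form → Form → Set₁
  VOr S A B = ∀ S' → Ext S S' → ∀ (p : At⊥)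
            → (∀ S'' → Ext S' S'' → V S'' A → VAt S'' p)
            → (∀ S'' → Ext S' S'' → V S'' B → VAt S'' p)
            → VAt S' p

  -- clause 5 via clause 8:  A ⊩^G_S B
  VImp : System → Form → Form → Set₁
  VImp S A B = ∀ S' → Ext S S'
             → (∀ S'' → Ext S' S'' → V S'' A)
             → (∀ S'' → Ext S' S'' → V S'' B)

_⊩L[_]_ : Form → System → Form → Set₁
A ⊩L[ S ] B = ∀ S' → Ext S S' → V S' A → V S' B

-- The classical atom p^c only asks that p alone does not derive ⊥, which holds in the
-- empty system, so ¬¬ p^i would have to hold there too. But ¬¬ p^i is then inherited by
-- the consistent extension with the rule "from p infer ⊥", where ¬ p^i holds in every
-- further extension; applying ¬¬ p^i to it yields a derivation of ⊥.
module Submission where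

open import Defs
open import Level using (lift; lower)
open import Data.Empty using (⊥)
open import Data.List using ([]; _∷_; [_])
open import Data.List.Relation.Unary.All using ([]; _∷_)
open import Data.List.Relation.Unary.Any using (here; there)
open import Data.Product using (_,_)
open import Relation.Binary.PropositionalEquality using (_≡_; refl)
open import Relation.Nullary using (¬_)

⊆S-refl : ∀ {S} → S ⊆S S
⊆S-refl _ r∈S = r∈S

Ext-refl : ∀ {S} → Consistent S → Ext S S
Ext-refl consistent = ⊆S-refl , consistent

∅ : System
∅ _ = ⊥

∅⊆S : ∀ {S} → ∅ ⊆S S
∅⊆S _ ()

∅-consistent : Consistent ∅
∅-consistent (hyp ())

atom⊬∅bot : ∀ n → ¬ ([ atom n ] ⊢[ ∅ ] bot)
atom⊬∅bot n (hyp (here ()))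
atom⊬∅bot n (hyp (there ()))

refute : At⊥ → Rule
refute p = mkRule [ [] , p ] bot

Refuting : At⊥ → System
Refuting p r = r ≡ refute p

⊬Refuting-atom : ∀ {p} n → ¬ ([] ⊢[ Refuting p ] atom n)
⊬Refuting-atom n (hyp ())

Refuting-atom-consistent : ∀ n → Consistent (Refuting (atom n))
Refuting-atom-consistent n (app _ refl (⊢p ∷ [])) = ⊬Refuting-atom n ⊢p

refute-⊩neg : ∀ {S p} → S (refute p) → ∀ S' → Ext S S' → V S' (neg (at i p))
refute-⊩neg refute∈S S' (S⊆S' , _) S'' (S'⊆S'' , _) ⊩p S''' S''≤S'''@(S''⊆S''' , _) =
  lift (app (refute _) (S''⊆S''' _ (S'⊆S'' _ (S⊆S' _ refute∈S)))
            (lower (⊩p S''' S''≤S''') ∷ []))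

neg-refutes-persistent : ∀ {S S' A} → VImp S A ⊥ᵢ → Ext S S'
                       → ¬ (∀ S'' → Ext S' S'' → V S'' A)
neg-refutes-persistent {S' = S'} ⊩¬A S≤S'@(_ , consistent') ⊩A =
  consistent' (lower (⊩¬A S' S≤S' ⊩A S' (Ext-refl consistent')))

theorem6 : ¬ (∀ (A : Form) (S : System) → Consistent S
               → withTag c A ⊩L[ S ] neg (neg (withTag i A)))
theorem6 entails =
  neg-refutes-persistent {A = neg p} ⊩¬¬p (∅⊆S , Refuting-atom-consistent 0) (refute-⊩neg refl)
  where
  p : Form
  p = at i (atom 0)

  ⊩¬¬p : V ∅ (neg (neg p))
  ⊩¬¬p = entails (at c (atom 0)) ∅ ∅-consistent ∅ (Ext-refl ∅-consistent)
                 (lift (atom⊬∅bot 0))
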